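{- Let $\mathcal{F}$ be a finite signature, $E$ a finite set of permutation equations over $\mathcal{F}$, $B$ a set of $B$-rules (possibly empty) for an interpreted symbol $g\in\mathcal{F}$, and let $(K,P,R)\vdash(K',P',R')$ be a single inference step by one of the rules EXTEND, SIMPLIFY, REWRITE, ORIENT, DEDUCE, DELETE, COMPOSE, COLLAPSE described below. Then for all ground terms $u,v\in\mathcal{T}(\mathcal{F}\cup K)$ we have $u\xleftrightarrow{*}_{E\cup B\cup P'\cup R'}v$ if and only if $u\xleftrightarrow{*}_{E\cup B\cup P\cup R}v$.
   Context: A permutation equation is an equation $f(x_1,\dots,x_n)\approx f(x_{\rho(1)},\dots,x_{\rho(n)})$ with $\rho$ a permutation of $\{1,\dots,n\}$; $\approx_E$ denotes the equational theory generated by $E$ (least congruence stable under substitutions containing $E$). $B$-rules for a binary interpreted symbol $g\in\mathcal{F}$ are one of: idempotency $\{g(x,x)\to x\}$, nilpotency $\{g(x,x)\to 0\}$, unit $\{g(x,0)\to x,\ g(0,x)\to x\}$, idempotency $\cup$ unit, or nilpotency $\cup$ unit (here $0$ is a constant); if $g$ occurs in $E$ then $g(x_1,x_2)\approx g(x_2,x_1)\in E$. Let $W=\{c_0,c_1,\dots\}$ be an infinite set of constants disjoint from $\mathcal{F}$, and $K$ a finite subset of $W$. A $D$-rule is a rule $f(c_1,\dots,c_n)\to c$ with $f\in\mathcal{F}$ of arity $n\ge 0$ and $c_1,\dots,c_n,c\in K$; a $C$-rule is a rule $c\to d$ with $c,d\in K$. The partial ordering $\succ$: $c_i\succ c_j$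 for $c_i,c_j\in K$ if $i<j$, and $t\succ c$ whenever $t\to c$ is a $D$-rule. A state is a triple $(K,P,R)$ with $K\subseteq W$ finite, $P$ a set of ground equations, $R$ a set of $D$- and $C$-rules. The inference rules are: EXTEND: $(K,P[t],R)\vdash(K\cup\{c\},P[c],R\cup\{t\to c\})$ if $t\to c$ is a $D$-rule, $c\in W\setminus K$, and $t$ occurs in some equation of $P$. SIMPLIFY: $(K,P[t],R\cup\{t\to c\})\vdash(K,P[c],R\cup\{t\to c\})$ if $t$ occurs in some equation of $P$. REWRITE: $(K,P,R\cup\{l'\to r'\})\vdash(K,P\cup\{r\sigma\approx r'\},R)$ if $l'=l\sigma$ for some $l\to r\in B$ and substitution $\sigma$. ORIENT: $(K,P\cup\{s\approx t\},R)\vdash(K,P,R\cup\{s\to t\})$ if $s\succ t$ and $s\to t$ is a $D$-rule or $C$-rule. DEDUCE: $(K,P,R\cup\{s\to c,t\to d\})\vdash(K,P\cup\{c\approx d\},R\cup\{t\to d\})$ if $s\approx_E t$. DELETE: $(K,P\cup\{s\approx t\},R)\vdash(K,P,R)$ if $s\approx_E t$. COMPOSE: $(K,P,R\cup\{t\to c,c\to d\})\vdash(K,P,R\cup\{t\to d,c\to d\})$. COLLAPSE: $(K,P,R\cup\{t[c]\to c',c\to d\})\vdash(K,P,R\cup\{t[d]\to c',c\to d\})$ if $c$ is a proper subterm of $t$ and $c\to d$ is a $C$-rule. -}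

module Defs where

open import Data.Nat using (ℕ; _<_)
open import Data.Fin using (Fin; toℕ; zero; suc)
open import Data.Fin.Permutation using (Permutation′; _⟨$⟩ʳ_)
open import Data.Vec using (Vec; []; _∷_; tabulate; lookup; _[_]≔_)
open import Data.List using (List; []; _∷_; _++_; map; concatMap)
open import Data.List.Membership.Propositional using (_∈_; _∉_)
open import Data.List.Relation.Binary.BagAndSetEquality using (_∼[_]_; set)
open import Data.Product using (Σ; ∃; ∃-syntax; _×_; _,_)
open import Data.Sum using (_⊎_)
open import Relation.Binary.PropositionalEquality using (_≡_; subst) renaming (sym to ≡sym)
open import Relation.Nullary using (¬_)
open import Relation.Binary.Construct.Closure.Equivalence using (EqClosure)

record Sig : Set where
  field
    size : ℕ
    ar   : Fin size → ℕ

module Over (S : Sig) where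
  open Sig S

  Sym : Set
  Sym = Fin size

  -- Terms over F ∪ W with variables; W = {c₀,c₁,…} is represented by con i = cᵢ.
  data Term : Set where
    var : ℕ → Term
    con : ℕ → Term
    app : (f : Sym) → Vec Term (ar f) → Term

  -- an equation s ≈ t / a rule s → t
  Eqn : Set
  Eqn = Term × Term

  Subst : Set
  Subst = ℕ → Term

  mutual
    _⟪_⟫ : Term → Subst → Term
    var x ⟪ σ ⟫ = σ x
    con c ⟪ σ ⟫ = con c
    app f ts ⟪ σ ⟫ = app f (substs ts σ)

    substs : ∀ {k} → Vec Term k → Subst → Vec Term k
    substs [] σ = []
    substs (t ∷ ts) σ = (t ⟪ σ ⟫) ∷ substs ts σ

  data Ctx : Set where
    hole : Ctx
    node : (f : Sym) → Vec Term (ar f) → Fin (ar f) → Ctx → Ctx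

  plug : Ctx → Term → Term
  plug hole t = t
  plug (node f ts i C) t = app f (ts [ i ]≔ plug C t)

  data GroundOver (K : List ℕ) : Term → Set where
    con : ∀ {c} → c ∈ K → GroundOver K (con c)
    app : ∀ {f ts} → (∀ i → GroundOver K (lookup ts i)) → GroundOver K (app f ts)

  record PermEq : Set where
    constructor perm
    field
      fsym : Sym
      ρ   : Permutation′ (ar fsym)

  permEqn : PermEq → Eqn
  permEqn (perm f ρ) =
    app f (tabulate (λ i → var (toℕ i))) , app f (tabulate (λ i → var (toℕ (ρ ⟨$⟩ʳ i))))

  data _≈[_]_ : Term → List PermEq → Term → Set where
    ax    : ∀ {E l r} → (l , r) ∈ map permEqn E → l ≈[ E ] r
    refl  : ∀ {E t} → t ≈[ E ] t
    sym   : ∀ {E s t} → s ≈[ E ] t → t ≈[ E ] s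
    trans : ∀ {E s t u} → s ≈[ E ] t → t ≈[ E ] u → s ≈[ E ] u
    cong  : ∀ {E} f (ss ts : Vec Term (ar f)) →
            (∀ i → lookup ss i ≈[ E ] lookup ts i) → app f ss ≈[ E ] app f ts
    inst  : ∀ {E s t} (σ : Subst) → s ≈[ E ] t → (s ⟪ σ ⟫) ≈[ E ] (t ⟪ σ ⟫)

  data BKind : Set where
    idem     : BKind
    nil      : (o : Sym) → ar o ≡ 0 → BKind
    unit     : (o : Sym) → ar o ≡ 0 → BKind
    idemUnit : (o : Sym) → ar o ≡ 0 → BKind
    nilUnit  : (o : Sym) → ar o ≡ 0 → BKind

  data BSpec : Set where
    noB   : BSpec
    withB : (g : Sym) → ar g ≡ 2 → BKind → BSpec

  bin : (g : Sym) → ar g ≡ 2 → Term → Term → Term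
  bin g p s t = app g (subst (Vec Term) (≡sym p) (s ∷ t ∷ []))

  const : (o : Sym) → ar o ≡ 0 → Term
  const o q = app o (subst (Vec Term) (≡sym q) [])

  x₁ x₂ : Term
  x₁ = var 0
  x₂ = var 1

  idemRules : (g : Sym) → ar g ≡ 2 → List Eqn
  idemRules g p = (bin g p x₁ x₁ , x₁) ∷ []

  nilRules : (g : Sym) → ar g ≡ 2 → (o : Sym) → ar o ≡ 0 → List Eqn
  nilRules g p o q = (bin g p x₁ x₁ , const o q) ∷ []

  unitRules : (g : Sym) → ar g ≡ 2 → (o : Sym) → ar o ≡ 0 → List Eqn
  unitRules g p o q = (bin g p x₁ (const o q) , x₁) ∷ (bin g p (const o q) x₁ , x₁) ∷ []

  BRules : BSpec → List Eqn
  BRules noB = []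
  BRules (withB g p idem) = idemRules g p
  BRules (withB g p (nil o q)) = nilRules g p o q
  BRules (withB g p (unit o q)) = unitRules g p o q
  BRules (withB g p (idemUnit o q)) = idemRules g p ++ unitRules g p o q
  BRules (withB g p (nilUnit o q)) = nilRules g p o q ++ unitRules g p o q

  CommAssumption : List PermEq → BSpec → Set
  CommAssumption E noB = ⊤′
    where open import Data.Unit using () renaming (⊤ to ⊤′)
  CommAssumption E (withB g p k) =
    (∃[ e ] (e ∈ E × PermEq.fsym e ≡ g)) →
    (bin g p x₁ x₂ , bin g p x₂ x₁) ∈ map permEqn E

  IsDRule : List ℕ → Eqn → Set
  IsDRule K (l , r) =
    ∃[ f ] ∃[ cs ] ∃[ c ] ((∀ i → lookup {n = ar f} cs i ∈ K) × c ∈ K ×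
      (l ≡ app f (Data.Vec.map con cs)) × (r ≡ con c))
    where import Data.Vec

  IsCRule : List ℕ → Eqn → Set
  IsCRule K (l , r) = ∃[ c ] ∃[ d ] (c ∈ K × d ∈ K × l ≡ con c × r ≡ con d)

  data Greater (K : List ℕ) : Term → Term → Set where
    consts : ∀ {i j} → i ∈ K → j ∈ K → i < j → Greater K (con i) (con j)
    drule  : ∀ {t c} → IsDRule K (t , c) → Greater K t c

  record State : Set where
    constructor ⟨_,_,_⟩
    field
      K : List ℕ
      P : List Eqn
      R : List Eqn

  IsState : State → Set
  IsState ⟨ K , P , R ⟩ =
    (∀ {s t} → (s , t) ∈ P → GroundOver K s × GroundOver K t) ×
    (∀ {e} → e ∈ R → IsDRule K e ⊎ IsCRule K e)

  -- sets are represented by lists up to set equality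
  _≋_ : List Eqn → List Eqn → Set
  xs ≋ ys = xs ∼[ set ] ys

  data Repl (t t' : Term) : Eqn → Eqn → Set where
    left  : ∀ C s → Repl t t' (plug C t , s) (plug C t' , s)
    right : ∀ C s → Repl t t' (s , plug C t) (s , plug C t')

  data _⊢[_,_]_ : State → List PermEq → BSpec → State → Set where
    EXTEND : ∀ {E B K P R P' R' P₀ e e'} t c →
      P ≋ (e ∷ P₀) → Repl t (con c) e e' → P' ≋ (e' ∷ P₀) →
      IsDRule (c ∷ K) (t , con c) → c ∉ K → R' ≋ ((t , con c) ∷ R) →
      ⟨ K , P , R ⟩ ⊢[ E , B ] ⟨ c ∷ K , P' , R' ⟩
    SIMPLIFY : ∀ {E B K P R P' P₀ e e'} t c →
      P ≋ (e ∷ P₀) → Repl t (con c) e e' → P' ≋ (e' ∷ P₀) →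
      (t , con c) ∈ R →
      ⟨ K , P , R ⟩ ⊢[ E , B ] ⟨ K , P' , R ⟩
    REWRITE : ∀ {E B K P R P' R₀} l r (σ : Subst) l' r' →
      R ≋ ((l' , r') ∷ R₀) → (l , r) ∈ BRules B → l' ≡ l ⟪ σ ⟫ →
      P' ≋ ((r ⟪ σ ⟫ , r') ∷ P) →
      ⟨ K , P , R ⟩ ⊢[ E , B ] ⟨ K , P' , R₀ ⟩
    ORIENT : ∀ {E B K P R P₀ R'} s t →
      P ≋ ((s , t) ∷ P₀) → Greater K s t → (IsDRule K (s , t) ⊎ IsCRule K (s , t)) →
      R' ≋ ((s , t) ∷ R) →
      ⟨ K , P , R ⟩ ⊢[ E , B ] ⟨ K , P₀ , R' ⟩
    DEDUCE : ∀ {E B K P R R₀ P' R'} s c t d →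
      R ≋ ((s , c) ∷ (t , d) ∷ R₀) → s ≈[ E ] t →
      P' ≋ ((c , d) ∷ P) → R' ≋ ((t , d) ∷ R₀) →
      ⟨ K , P , R ⟩ ⊢[ E , B ] ⟨ K , P' , R' ⟩
    DELETE : ∀ {E B K P R P₀} s t →
      P ≋ ((s , t) ∷ P₀) → s ≈[ E ] t →
      ⟨ K , P , R ⟩ ⊢[ E , B ] ⟨ K , P₀ , R ⟩
    COMPOSE : ∀ {E B K P R R₀ R'} t c d →
      R ≋ ((t , c) ∷ (c , d) ∷ R₀) → R' ≋ ((t , d) ∷ (c , d) ∷ R₀) →
      ⟨ K , P , R ⟩ ⊢[ E , B ] ⟨ K , P , R' ⟩
    COLLAPSE : ∀ {E B K P R R₀ R'} (C : Ctx) c c' d →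
      ¬ (C ≡ hole) →
      R ≋ ((plug C (con c) , c') ∷ (con c , con d) ∷ R₀) → IsCRule K (con c , con d) →
      R' ≋ ((plug C (con d) , c') ∷ (con c , con d) ∷ R₀) →
      ⟨ K , P , R ⟩ ⊢[ E , B ] ⟨ K , P , R' ⟩

  data OneStep (Ax : List Eqn) : Term → Term → Set where
    step : ∀ {l r} → (l , r) ∈ Ax → (C : Ctx) (σ : Subst) →
           OneStep Ax (plug C (l ⟪ σ ⟫)) (plug C (r ⟪ σ ⟫))

  _↔*[_]_ : Term → List Eqn → Term → Set
  u ↔*[ Ax ] v = EqClosure (OneStep Ax) u v

  Axioms : List PermEq → BSpec → State → List Eqn
  Axioms E B ⟨ K , P , R ⟩ = map permEqn E ++ BRules B ++ P ++ R

{-# OPTIONS --safe #-}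
module Submission where

-- Except for EXTEND, every inference replaces E ∪ B ∪ P ∪ R by a set of equations each of which
-- is derivable from the other set (DEDUCE and DELETE use ≈_E ⊆ ↔*_E), so both sets generate the
-- same relation ↔*.  EXTEND introduces a fresh constant c with t → c: after substituting t for c
-- the old axioms derive every new one, and this substitution leaves unchanged the ground terms
-- over K (which do not contain c) and the axioms of E and B (which contain no constants).

open import Defs
open import Data.Nat using (ℕ; _≟_)
open import Data.Fin using (zero; suc)
open import Data.List using (List; []; _∷_; _++_; map)
open import Data.List.Membership.Propositional using (_∈_; _∉_)
open import Data.List.Membership.Propositional.Properties using (∈-++⁺ˡ; ∈-++⁺ʳ)
open import Data.List.Relation.Binary.Subset.Propositional using (_⊆_)
open import Data.List.Relation.Unary.All as All using (All; []; _∷_)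
open import Data.List.Relation.Unary.All.Properties using (++⁺; anti-mono; map⁺)
open import Data.List.Relation.Unary.Any using (here; there)
open import Data.Vec using (Vec; []; _∷_; lookup; _[_]≔_)
import Data.Vec as Vec
open import Data.Vec.Properties using (lookup-map; lookup∘update; map-[]≔)
import Data.Vec.Relation.Unary.All as VAll
open import Data.Vec.Relation.Unary.All.Properties using (tabulate⁺)
open import Data.Product using (_×_; _,_; proj₁; proj₂)
open import Data.Sum using (_⊎_; inj₁; inj₂)
open import Data.Empty using (⊥-elim)
open import Function using (_∘_)
open import Function.Bundles using (_⇔_; mk⇔; Equivalence)
open import Relation.Nullary using (yes; no)
open import Relation.Binary.PropositionalEquality
  using (_≡_; refl; sym; trans; cong; cong₂; subst; subst₂; module ≡-Reasoning)
open import Relation.Binary.Construct.Closure.Equivalence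
  using (symmetric; isEquivalence; gmap; gfold; return; _⋆)
open import Relation.Binary.Construct.Closure.ReflexiveTransitive using (ε; _◅◅_)

module Terms (S : Sig) where
  open Sig S using (ar)
  open Over S
    renaming (ax to ≈-ax; refl to ≈-refl; sym to ≈-sym; trans to ≈-trans; cong to ≈-cong; inst to ≈-inst)

  mutual
    ⟪⟫-identity : ∀ x → x ⟪ var ⟫ ≡ x
    ⟪⟫-identity (var v) = refl
    ⟪⟫-identity (con c) = refl
    ⟪⟫-identity (app f ts) = cong (app f) (⟪⟫ᵛ-identity ts)

    ⟪⟫ᵛ-identity : ∀ {n} (ts : Vec Term n) → substs ts var ≡ ts
    ⟪⟫ᵛ-identity [] = refl
    ⟪⟫ᵛ-identity (t ∷ ts) = cong₂ _∷_ (⟪⟫-identity t) (⟪⟫ᵛ-identity ts)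

  mutual
    ⟪⟫-compose : ∀ x σ τ → (x ⟪ σ ⟫) ⟪ τ ⟫ ≡ x ⟪ (λ v → σ v ⟪ τ ⟫) ⟫
    ⟪⟫-compose (var v) σ τ = refl
    ⟪⟫-compose (con c) σ τ = refl
    ⟪⟫-compose (app f ts) σ τ = cong (app f) (⟪⟫ᵛ-compose ts σ τ)

    ⟪⟫ᵛ-compose : ∀ {n} (ts : Vec Term n) σ τ →
                  substs (substs ts σ) τ ≡ substs ts (λ v → σ v ⟪ τ ⟫)
    ⟪⟫ᵛ-compose [] σ τ = refl
    ⟪⟫ᵛ-compose (t ∷ ts) σ τ = cong₂ _∷_ (⟪⟫-compose t σ τ) (⟪⟫ᵛ-compose ts σ τ)

  ⟪⟫ᵛ-map : ∀ {n} (ts : Vec Term n) σ → substs ts σ ≡ Vec.map (_⟪ σ ⟫) ts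
  ⟪⟫ᵛ-map [] σ = refl
  ⟪⟫ᵛ-map (t ∷ ts) σ = cong (t ⟪ σ ⟫ ∷_) (⟪⟫ᵛ-map ts σ)

  mutual
    ⟪⟫-ground : ∀ {K} x σ → GroundOver K x → x ⟪ σ ⟫ ≡ x
    ⟪⟫-ground (con c) σ _ = refl
    ⟪⟫-ground (app f ts) σ (app g) = cong (app f) (⟪⟫ᵛ-ground ts σ g)

    ⟪⟫ᵛ-ground : ∀ {K n} (ts : Vec Term n) σ →
                 (∀ i → GroundOver K (lookup ts i)) → substs ts σ ≡ ts
    ⟪⟫ᵛ-ground [] σ _ = refl
    ⟪⟫ᵛ-ground (t ∷ ts) σ g =
      cong₂ _∷_ (⟪⟫-ground t σ (g zero)) (⟪⟫ᵛ-ground ts σ (g ∘ suc))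

  mapCtx : (Term → Term) → Ctx → Ctx
  mapCtx h hole = hole
  mapCtx h (node f ts i C) = node f (Vec.map h ts) i (mapCtx h C)

  plug-map : (h : Term → Term) → (∀ {f} ts → h (app f ts) ≡ app f (Vec.map h ts)) →
             ∀ C x → h (plug C x) ≡ plug (mapCtx h C) (h x)
  plug-map h h-app hole x = refl
  plug-map h h-app (node f ts i C) x = begin
    h (app f (ts [ i ]≔ plug C x))
      ≡⟨ h-app _ ⟩
    app f (Vec.map h (ts [ i ]≔ plug C x))
      ≡⟨ cong (app f) (map-[]≔ h ts i) ⟩
    app f (Vec.map h ts [ i ]≔ h (plug C x))
      ≡⟨ cong (λ y → app f (Vec.map h ts [ i ]≔ y)) (plug-map h h-app C x) ⟩
    app f (Vec.map h ts [ i ]≔ plug (mapCtx h C) (h x)) ∎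
    where open ≡-Reasoning

  plug-⟪⟫ : ∀ C x σ → plug C x ⟪ σ ⟫ ≡ plug (mapCtx (_⟪ σ ⟫) C) (x ⟪ σ ⟫)
  plug-⟪⟫ C x σ = plug-map (_⟪ σ ⟫) (λ ts → cong (app _) (⟪⟫ᵛ-map ts σ)) C x

  _∘ᶜ_ : Ctx → Ctx → Ctx
  hole ∘ᶜ D = D
  node f ts i C ∘ᶜ D = node f ts i (C ∘ᶜ D)

  plug-∘ᶜ : ∀ C D x → plug C (plug D x) ≡ plug (C ∘ᶜ D) x
  plug-∘ᶜ hole D x = refl
  plug-∘ᶜ (node f ts i C) D x = cong (λ y → app f (ts [ i ]≔ y)) (plug-∘ᶜ C D x)

  plug-ground : ∀ {K} C t → GroundOver K (plug C t) → GroundOver K t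
  plug-ground hole t g = g
  plug-ground (node f ts i C) t (app g) =
    plug-ground C t (subst (GroundOver _) (lookup∘update i ts (plug C t)) (g i))

  GroundEqn : List ℕ → Eqn → Set
  GroundEqn K e = GroundOver K (proj₁ e) × GroundOver K (proj₂ e)

  rule-ground : ∀ {K l r} → IsDRule K (l , r) ⊎ IsCRule K (l , r) → GroundEqn K (l , r)
  rule-ground (inj₁ (f , cs , c , cs∈K , c∈K , refl , refl)) =
    app (λ i → subst (GroundOver _) (sym (lookup-map i con cs)) (con (cs∈K i))) , con c∈K
  rule-ground (inj₂ (c , d , c∈K , d∈K , refl , refl)) = con c∈K , con d∈K

  Repl-sym : ∀ {t t' e e'} → Repl t t' e e' → Repl t' t e' e
  Repl-sym (left C s) = left C s
  Repl-sym (right C s) = right C s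

  Repl-ground : ∀ {K t t' e e'} → Repl t t' e e' → GroundEqn K e → GroundOver K t
  Repl-ground (left C s) (g , _) = plug-ground C _ g
  Repl-ground (right C s) (_ , g) = plug-ground C _ g

  mutual
    _⟦_⟧ : Term → (ℕ → Term) → Term
    var v ⟦ θ ⟧ = var v
    con c ⟦ θ ⟧ = θ c
    app f ts ⟦ θ ⟧ = app f (ts ⟦ θ ⟧ᵛ)

    _⟦_⟧ᵛ : ∀ {n} → Vec Term n → (ℕ → Term) → Vec Term n
    [] ⟦ θ ⟧ᵛ = []
    (t ∷ ts) ⟦ θ ⟧ᵛ = t ⟦ θ ⟧ ∷ ts ⟦ θ ⟧ᵛ

  _⟦_⟧ₑ : Eqn → (ℕ → Term) → Eqn
  e ⟦ θ ⟧ₑ = proj₁ e ⟦ θ ⟧ , proj₂ e ⟦ θ ⟧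

  ⟦⟧ᵛ-map : ∀ {n} (ts : Vec Term n) θ → ts ⟦ θ ⟧ᵛ ≡ Vec.map (_⟦ θ ⟧) ts
  ⟦⟧ᵛ-map [] θ = refl
  ⟦⟧ᵛ-map (t ∷ ts) θ = cong (t ⟦ θ ⟧ ∷_) (⟦⟧ᵛ-map ts θ)

  plug-⟦⟧ : ∀ C x θ → plug C x ⟦ θ ⟧ ≡ plug (mapCtx (_⟦ θ ⟧) C) (x ⟦ θ ⟧)
  plug-⟦⟧ C x θ = plug-map (_⟦ θ ⟧) (λ ts → cong (app _) (⟦⟧ᵛ-map ts θ)) C x

  ClosedValued : (ℕ → Term) → Set
  ClosedValued θ = ∀ d σ → θ d ⟪ σ ⟫ ≡ θ d

  mutual
    ⟪⟫-⟦⟧ : ∀ {θ} → ClosedValued θ → ∀ x σ →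
            (x ⟪ σ ⟫) ⟦ θ ⟧ ≡ (x ⟦ θ ⟧) ⟪ (λ v → σ v ⟦ θ ⟧) ⟫
    ⟪⟫-⟦⟧ closed (var v) σ = refl
    ⟪⟫-⟦⟧ closed (con d) σ = sym (closed d _)
    ⟪⟫-⟦⟧ closed (app f ts) σ = cong (app f) (⟪⟫ᵛ-⟦⟧ᵛ closed ts σ)

    ⟪⟫ᵛ-⟦⟧ᵛ : ∀ {θ} → ClosedValued θ → ∀ {n} (ts : Vec Term n) σ →
              substs ts σ ⟦ θ ⟧ᵛ ≡ substs (ts ⟦ θ ⟧ᵛ) (λ v → σ v ⟦ θ ⟧)
    ⟪⟫ᵛ-⟦⟧ᵛ closed [] σ = refl
    ⟪⟫ᵛ-⟦⟧ᵛ closed (t ∷ ts) σ = cong₂ _∷_ (⟪⟫-⟦⟧ closed t σ) (⟪⟫ᵛ-⟦⟧ᵛ closed ts σ)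

  Fixes : List ℕ → (ℕ → Term) → Set
  Fixes K θ = ∀ {d} → d ∈ K → θ d ≡ con d

  mutual
    ⟦⟧-ground : ∀ {K θ} → Fixes K θ → ∀ x → GroundOver K x → x ⟦ θ ⟧ ≡ x
    ⟦⟧-ground fixes (con d) (con d∈K) = fixes d∈K
    ⟦⟧-ground fixes (app f ts) (app g) = cong (app f) (⟦⟧ᵛ-ground fixes ts g)

    ⟦⟧ᵛ-ground : ∀ {K θ} → Fixes K θ → ∀ {n} (ts : Vec Term n) →
                 (∀ i → GroundOver K (lookup ts i)) → ts ⟦ θ ⟧ᵛ ≡ ts
    ⟦⟧ᵛ-ground fixes [] _ = refl
    ⟦⟧ᵛ-ground fixes (t ∷ ts) g =
      cong₂ _∷_ (⟦⟧-ground fixes t (g zero)) (⟦⟧ᵛ-ground fixes ts (g ∘ suc))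

  ⟦⟧ₑ-ground : ∀ {K θ e} → Fixes K θ → GroundEqn K e → e ⟦ θ ⟧ₑ ≡ e
  ⟦⟧ₑ-ground fixes (gl , gr) = cong₂ _,_ (⟦⟧-ground fixes _ gl) (⟦⟧-ground fixes _ gr)

  plug-cong-⟦⟧ : ∀ {θ} C {t t'} → t ⟦ θ ⟧ ≡ t' ⟦ θ ⟧ → plug C t ⟦ θ ⟧ ≡ plug C t' ⟦ θ ⟧
  plug-cong-⟦⟧ {θ} C {t} {t'} eq =
    trans (plug-⟦⟧ C t θ) (trans (cong (plug _) eq) (sym (plug-⟦⟧ C t' θ)))

  Repl-⟦⟧ : ∀ {θ t t' e e'} → t ⟦ θ ⟧ ≡ t' ⟦ θ ⟧ → Repl t t' e e' → e ⟦ θ ⟧ₑ ≡ e' ⟦ θ ⟧ₑ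
  Repl-⟦⟧ {θ} eq (left C s) = cong (_, s ⟦ θ ⟧) (plug-cong-⟦⟧ C eq)
  Repl-⟦⟧ {θ} eq (right C s) = cong (s ⟦ θ ⟧ ,_) (plug-cong-⟦⟧ C eq)

  data ConstFree : Term → Set where
    var : ∀ {v} → ConstFree (var v)
    app : ∀ {f ts} → VAll.All ConstFree ts → ConstFree (app f ts)

  ConstFreeEqn : Eqn → Set
  ConstFreeEqn e = ConstFree (proj₁ e) × ConstFree (proj₂ e)

  mutual
    ⟦⟧-constFree : ∀ {θ x} → ConstFree x → x ⟦ θ ⟧ ≡ x
    ⟦⟧-constFree var = refl
    ⟦⟧-constFree (app cfs) = cong (app _) (⟦⟧ᵛ-constFree cfs)

    ⟦⟧ᵛ-constFree : ∀ {θ n} {ts : Vec Term n} → VAll.All ConstFree ts → ts ⟦ θ ⟧ᵛ ≡ ts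
    ⟦⟧ᵛ-constFree VAll.[] = refl
    ⟦⟧ᵛ-constFree (cf VAll.∷ cfs) = cong₂ _∷_ (⟦⟧-constFree cf) (⟦⟧ᵛ-constFree cfs)

  ⟦⟧ₑ-constFree : ∀ {θ e} → ConstFreeEqn e → e ⟦ θ ⟧ₑ ≡ e
  ⟦⟧ₑ-constFree (cl , cr) = cong₂ _,_ (⟦⟧-constFree cl) (⟦⟧-constFree cr)

  permEqn-constFree : ∀ e → ConstFreeEqn (permEqn e)
  permEqn-constFree (perm f ρ) = app (tabulate⁺ (λ _ → var)) , app (tabulate⁺ (λ _ → var))

  All-subst : ∀ {m n} {P : Term → Set} (q : m ≡ n) {ts : Vec Term m} →
              VAll.All P ts → VAll.All P (subst (Vec Term) q ts)
  All-subst refl ps = ps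

  bin-constFree : ∀ {g} (p : ar g ≡ 2) {a b} →
                  ConstFree a → ConstFree b → ConstFree (bin g p a b)
  bin-constFree p ca cb = app (All-subst (sym p) (ca VAll.∷ cb VAll.∷ VAll.[]))

  const-constFree : ∀ {o} (q : ar o ≡ 0) → ConstFree (const o q)
  const-constFree q = app (All-subst (sym q) VAll.[])

  idemRules-constFree : ∀ {g} (p : ar g ≡ 2) → All ConstFreeEqn (idemRules g p)
  idemRules-constFree p = (bin-constFree p var var , var) ∷ []

  nilRules-constFree : ∀ {g o} (p : ar g ≡ 2) (q : ar o ≡ 0) →
                       All ConstFreeEqn (nilRules g p o q)
  nilRules-constFree p q = (bin-constFree p var var , const-constFree q) ∷ []

  unitRules-constFree : ∀ {g o} (p : ar g ≡ 2) (q : ar o ≡ 0) →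
                        All ConstFreeEqn (unitRules g p o q)
  unitRules-constFree p q =
    (bin-constFree p var (const-constFree q) , var) ∷
    (bin-constFree p (const-constFree q) var , var) ∷ []

  BRules-constFree : ∀ B → All ConstFreeEqn (BRules B)
  BRules-constFree noB = []
  BRules-constFree (withB g p idem) = idemRules-constFree p
  BRules-constFree (withB g p (nil o q)) = nilRules-constFree p q
  BRules-constFree (withB g p (unit o q)) = unitRules-constFree p q
  BRules-constFree (withB g p (idemUnit o q)) =
    ++⁺ (idemRules-constFree p) (unitRules-constFree p q)
  BRules-constFree (withB g p (nilUnit o q)) =
    ++⁺ (nilRules-constFree p q) (unitRules-constFree p q)

  _↦_ : ℕ → Term → ℕ → Term
  (c ↦ t) d with d ≟ c
  ... | yes _ = t
  ... | no _ = con d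

  ↦-same : ∀ c t → (c ↦ t) c ≡ t
  ↦-same c t with c ≟ c
  ... | yes _ = refl
  ... | no c≢c = ⊥-elim (c≢c refl)

  ↦-fixes : ∀ {K c} t → c ∉ K → Fixes K (c ↦ t)
  ↦-fixes {c = c} t c∉K {d} d∈K with d ≟ c
  ... | yes refl = ⊥-elim (c∉K d∈K)
  ... | no _ = refl

  ↦-closed : ∀ {K} c {t} → GroundOver K t → ClosedValued (c ↦ t)
  ↦-closed c {t} t-ground d σ with d ≟ c
  ... | yes _ = ⟪⟫-ground t σ t-ground
  ... | no _ = refl

  ≡⇒↔* : ∀ {Ax u v} → u ≡ v → u ↔*[ Ax ] v
  ≡⇒↔* refl = ε

  ↔*-sym : ∀ {Ax u v} → u ↔*[ Ax ] v → v ↔*[ Ax ] u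
  ↔*-sym = symmetric _

  axiom : ∀ {Ax l r} → (l , r) ∈ Ax → l ↔*[ Ax ] r
  axiom {Ax} {l} {r} m =
    subst₂ (λ a b → a ↔*[ Ax ] b) (⟪⟫-identity l) (⟪⟫-identity r) (return (step m hole var))

  OneStep-⟪⟫ : ∀ {Ax} τ {a b} → OneStep Ax a b → OneStep Ax (a ⟪ τ ⟫) (b ⟪ τ ⟫)
  OneStep-⟪⟫ τ (step {l} {r} m C σ) =
    subst₂ (OneStep _) (sym (commute l)) (sym (commute r))
      (step m (mapCtx (_⟪ τ ⟫) C) (λ v → σ v ⟪ τ ⟫))
    where
    commute : ∀ x → plug C (x ⟪ σ ⟫) ⟪ τ ⟫ ≡
                    plug (mapCtx (_⟪ τ ⟫) C) (x ⟪ (λ v → σ v ⟪ τ ⟫) ⟫)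
    commute x = trans (plug-⟪⟫ C (x ⟪ σ ⟫) τ) (cong (plug _) (⟪⟫-compose x σ τ))

  OneStep-plug : ∀ {Ax} D {a b} → OneStep Ax a b → OneStep Ax (plug D a) (plug D b)
  OneStep-plug D (step {l} {r} m C σ) =
    subst₂ (OneStep _) (sym (plug-∘ᶜ D C (l ⟪ σ ⟫))) (sym (plug-∘ᶜ D C (r ⟪ σ ⟫)))
      (step m (D ∘ᶜ C) σ)

  ↔*-⟪⟫ : ∀ {Ax} σ {u v} → u ↔*[ Ax ] v → (u ⟪ σ ⟫) ↔*[ Ax ] (v ⟪ σ ⟫)
  ↔*-⟪⟫ σ = gmap (_⟪ σ ⟫) (OneStep-⟪⟫ σ)

  ↔*-plug : ∀ {Ax} C {u v} → u ↔*[ Ax ] v → plug C u ↔*[ Ax ] plug C v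
  ↔*-plug C = gmap (plug C) (OneStep-plug C)

  ↔*-pointwise : ∀ {Ax n} (h : Vec Term n → Term) →
                 (∀ vs i {a b} → a ↔*[ Ax ] b → h (vs [ i ]≔ a) ↔*[ Ax ] h (vs [ i ]≔ b)) →
                 ∀ ss ts → (∀ i → lookup ss i ↔*[ Ax ] lookup ts i) → h ss ↔*[ Ax ] h ts
  ↔*-pointwise h h-cong [] [] _ = ε
  ↔*-pointwise h h-cong (s ∷ ss) (t ∷ ts) st =
    h-cong (s ∷ ss) zero (st zero) ◅◅
    ↔*-pointwise (h ∘ (t ∷_)) (λ vs i → h-cong (t ∷ vs) (suc i)) ss ts (st ∘ suc)

  ≈⇒↔* : ∀ {E Ax} → map permEqn E ⊆ Ax → ∀ {s t} → s ≈[ E ] t → s ↔*[ Ax ] t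
  ≈⇒↔* E⊆Ax (≈-ax m) = axiom (E⊆Ax m)
  ≈⇒↔* E⊆Ax ≈-refl = ε
  ≈⇒↔* E⊆Ax (≈-sym p) = ↔*-sym (≈⇒↔* E⊆Ax p)
  ≈⇒↔* E⊆Ax (≈-trans p q) = ≈⇒↔* E⊆Ax p ◅◅ ≈⇒↔* E⊆Ax q
  ≈⇒↔* E⊆Ax (≈-cong f ss ts ps) =
    ↔*-pointwise (app f) (λ vs i → ↔*-plug (node f vs i hole)) ss ts (λ i → ≈⇒↔* E⊆Ax (ps i))
  ≈⇒↔* E⊆Ax (≈-inst σ p) = ↔*-⟪⟫ σ (≈⇒↔* E⊆Ax p)

  infix 4 _⊨_
  _⊨_ : List Eqn → Eqn → Set
  Ax ⊨ e = proj₁ e ↔*[ Ax ] proj₂ e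

  Entails : List Eqn → List Eqn → Set
  Entails Ax Ax' = All (Ax ⊨_) Ax'

  EntailsUnder : (ℕ → Term) → List Eqn → List Eqn → Set
  EntailsUnder θ Ax Ax' = All (λ e → Ax ⊨ e ⟦ θ ⟧ₑ) Ax'

  Interderivable : List Eqn → List Eqn → Set
  Interderivable Ax Ax' = Entails Ax Ax' × Entails Ax' Ax

  axioms : ∀ {Ax xs} → xs ⊆ Ax → Entails Ax xs
  axioms xs⊆Ax = All.tabulate (axiom ∘ xs⊆Ax)

  ↔*-mono : ∀ {Ax Ax'} → Entails Ax Ax' → ∀ {u v} → u ↔*[ Ax' ] v → u ↔*[ Ax ] v
  ↔*-mono h = (λ { (step m C σ) → ↔*-plug C (↔*-⟪⟫ σ (All.lookup h m)) }) ⋆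

  interderivable⇒⇔ : ∀ {Ax Ax'} → Interderivable Ax Ax' →
                     ∀ {u v} → (u ↔*[ Ax' ] v) ⇔ (u ↔*[ Ax ] v)
  interderivable⇒⇔ (h , h') = mk⇔ (↔*-mono h) (↔*-mono h')

  fixed-axioms : ∀ {θ Ax xs} → xs ⊆ Ax → All (λ e → e ⟦ θ ⟧ₑ ≡ e) xs → EntailsUnder θ Ax xs
  fixed-axioms {Ax = Ax} xs⊆Ax fixed =
    All.tabulate (λ m → subst (Ax ⊨_) (sym (All.lookup fixed m)) (axiom (xs⊆Ax m)))

  ↔*-⟦⟧ : ∀ {Ax Ax' θ} → ClosedValued θ → EntailsUnder θ Ax Ax' →
          ∀ {u v} → u ↔*[ Ax' ] v → (u ⟦ θ ⟧) ↔*[ Ax ] (v ⟦ θ ⟧)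
  ↔*-⟦⟧ {Ax} {Ax'} {θ} closed h = gfold (isEquivalence _) (_⟦ θ ⟧) image
    where
    image : ∀ {a b} → OneStep Ax' a b → (a ⟦ θ ⟧) ↔*[ Ax ] (b ⟦ θ ⟧)
    image (step {l} {r} m C σ) =
      subst₂ (λ a b → a ↔*[ Ax ] b) (sym (commute l)) (sym (commute r))
        (↔*-plug _ (↔*-⟪⟫ _ (All.lookup h m)))
      where
      commute : ∀ x → plug C (x ⟪ σ ⟫) ⟦ θ ⟧ ≡
                      plug (mapCtx (_⟦ θ ⟧) C) ((x ⟦ θ ⟧) ⟪ (λ v → σ v ⟦ θ ⟧) ⟫)
      commute x = trans (plug-⟦⟧ C (x ⟪ σ ⟫) θ) (cong (plug _) (⟪⟫-⟦⟧ closed x σ))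

  ≋⇒⊆ : ∀ {xs ys : List Eqn} → xs ≋ ys → xs ⊆ ys
  ≋⇒⊆ eq = Equivalence.to eq

  ≋⇒⊇ : ∀ {xs ys : List Eqn} → xs ≋ ys → ys ⊆ xs
  ≋⇒⊇ eq = Equivalence.from eq

  ≋-head : ∀ {xs ys : List Eqn} {e} → xs ≋ (e ∷ ys) → e ∈ xs
  ≋-head eq = Equivalence.from eq (here refl)

  ≋-tail : ∀ {xs ys : List Eqn} {e} → xs ≋ (e ∷ ys) → ys ⊆ xs
  ≋-tail eq = Equivalence.from eq ∘ there

  entails-≋∷ : ∀ {Ax xs ys e} → xs ≋ (e ∷ ys) → Ax ⊨ e → ys ⊆ Ax → Entails Ax xs
  entails-≋∷ eq ⊨e ys⊆Ax = anti-mono (≋⇒⊆ eq) (⊨e ∷ axioms ys⊆Ax)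

  Repl-⊨ : ∀ {Ax t t' e e'} → Repl t t' e e' → t ↔*[ Ax ] t' → Ax ⊨ e → Ax ⊨ e'
  Repl-⊨ (left C s) t↔t' ⊨e = ↔*-sym (↔*-plug C t↔t') ◅◅ ⊨e
  Repl-⊨ (right C s) t↔t' ⊨e = ⊨e ◅◅ ↔*-plug C t↔t'

  replace-entails : ∀ {Ax t t' e e' xs ys zs} → Repl t t' e e' → t ↔*[ Ax ] t' →
                    xs ≋ (e ∷ zs) → ys ≋ (e' ∷ zs) → xs ⊆ Ax → Entails Ax ys
  replace-entails rp t↔t' xs≋ ys≋ xs⊆Ax =
    entails-≋∷ ys≋ (Repl-⊨ rp t↔t' (axiom (xs⊆Ax (≋-head xs≋)))) (xs⊆Ax ∘ ≋-tail xs≋)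

module Inference (S : Sig) (E : List (Over.PermEq S)) (B : Over.BSpec S) where
  open Over S hiding (ax; refl; sym; trans; cong; inst)
  open Terms S

  Ax : List Eqn → List Eqn → List Eqn
  Ax P R = map permEqn E ++ BRules B ++ P ++ R

  E⊆Ax : ∀ P R → map permEqn E ⊆ Ax P R
  E⊆Ax P R = ∈-++⁺ˡ

  B⊆Ax : ∀ P R → BRules B ⊆ Ax P R
  B⊆Ax P R = ∈-++⁺ʳ (map permEqn E) ∘ ∈-++⁺ˡ

  P⊆Ax : ∀ P R → P ⊆ Ax P R
  P⊆Ax P R = ∈-++⁺ʳ (map permEqn E) ∘ ∈-++⁺ʳ (BRules B) ∘ ∈-++⁺ˡ

  R⊆Ax : ∀ P R → R ⊆ Ax P R
  R⊆Ax P R = ∈-++⁺ʳ (map permEqn E) ∘ ∈-++⁺ʳ (BRules B) ∘ ∈-++⁺ʳ P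

  Ax-entails : ∀ P R {P' R'} → Entails (Ax P R) P' → Entails (Ax P R) R' →
               Entails (Ax P R) (Ax P' R')
  Ax-entails P R hP hR = ++⁺ (axioms (E⊆Ax P R)) (++⁺ (axioms (B⊆Ax P R)) (++⁺ hP hR))

  Ax-entailsUnder : ∀ {θ} P R {P' R'} →
                    EntailsUnder θ (Ax P R) P' → EntailsUnder θ (Ax P R) R' →
                    EntailsUnder θ (Ax P R) (Ax P' R')
  Ax-entailsUnder {θ} P R hP hR = ++⁺ E-images (++⁺ B-images (++⁺ hP hR))
    where
    E-images : EntailsUnder θ (Ax P R) (map permEqn E)
    E-images = fixed-axioms (E⊆Ax P R)
      (All.map ⟦⟧ₑ-constFree (map⁺ (All.universal permEqn-constFree E)))
    B-images : EntailsUnder θ (Ax P R) (BRules B)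
    B-images = fixed-axioms (B⊆Ax P R) (All.map ⟦⟧ₑ-constFree (BRules-constFree B))

  interderivable : ∀ P R P' R' → Entails (Ax P R) P' → Entails (Ax P R) R' →
                   Entails (Ax P' R') P → Entails (Ax P' R') R → Interderivable (Ax P R) (Ax P' R')
  interderivable P R P' R' hP' hR' hP hR = Ax-entails P R hP' hR' , Ax-entails P' R' hP hR

  SIMPLIFY-interderivable : ∀ P R {P' P₀ e e' t c} →
    P ≋ (e ∷ P₀) → Repl t (con c) e e' → P' ≋ (e' ∷ P₀) → (t , con c) ∈ R →
    Interderivable (Ax P R) (Ax P' R)
  SIMPLIFY-interderivable P R {P'} Peq rp P'eq tc∈R = interderivable P R P' R
    (replace-entails rp (axiom (R⊆Ax P R tc∈R)) Peq P'eq (P⊆Ax P R)) (axioms (R⊆Ax P R))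
    (replace-entails (Repl-sym rp) (↔*-sym (axiom (R⊆Ax P' R tc∈R))) P'eq Peq (P⊆Ax P' R))
    (axioms (R⊆Ax P' R))

  REWRITE-interderivable : ∀ P R {P' R₀ l r r'} σ →
    R ≋ ((l ⟪ σ ⟫ , r') ∷ R₀) → (l , r) ∈ BRules B → P' ≋ ((r ⟪ σ ⟫ , r') ∷ P) →
    Interderivable (Ax P R) (Ax P' R₀)
  REWRITE-interderivable P R {P'} {R₀} {l} {r} σ Req lr∈B P'eq = interderivable P R P' R₀
    (entails-≋∷ P'eq (↔*-sym (B-instance P R) ◅◅ axiom (R⊆Ax P R (≋-head Req))) (P⊆Ax P R))
    (axioms (R⊆Ax P R ∘ ≋-tail Req))
    (axioms (P⊆Ax P' R₀ ∘ ≋-tail P'eq))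
    (entails-≋∷ Req (B-instance P' R₀ ◅◅ axiom (P⊆Ax P' R₀ (≋-head P'eq))) (R⊆Ax P' R₀))
    where
    B-instance : ∀ P R → (l ⟪ σ ⟫) ↔*[ Ax P R ] (r ⟪ σ ⟫)
    B-instance P R = ↔*-⟪⟫ σ (axiom (B⊆Ax P R lr∈B))

  ORIENT-interderivable : ∀ P R {P₀ R' s t} →
    P ≋ ((s , t) ∷ P₀) → R' ≋ ((s , t) ∷ R) → Interderivable (Ax P R) (Ax P₀ R')
  ORIENT-interderivable P R {P₀} {R'} Peq R'eq = interderivable P R P₀ R'
    (axioms (P⊆Ax P R ∘ ≋-tail Peq))
    (entails-≋∷ R'eq (axiom (P⊆Ax P R (≋-head Peq))) (R⊆Ax P R))
    (entails-≋∷ Peq (axiom (R⊆Ax P₀ R' (≋-head R'eq))) (P⊆Ax P₀ R'))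
    (axioms (R⊆Ax P₀ R' ∘ ≋-tail R'eq))

  DEDUCE-interderivable : ∀ P R {P' R' R₀ s c t d} →
    R ≋ ((s , c) ∷ (t , d) ∷ R₀) → s ≈[ E ] t → P' ≋ ((c , d) ∷ P) → R' ≋ ((t , d) ∷ R₀) →
    Interderivable (Ax P R) (Ax P' R')
  DEDUCE-interderivable P R {P'} {R'} {s = s} {c} {t} {d} Req s≈t P'eq R'eq =
    interderivable P R P' R'
    (entails-≋∷ P'eq (↔*-sym s→c ◅◅ ≈⇒↔* (E⊆Ax P R) s≈t ◅◅ t→d) (P⊆Ax P R))
    (axioms (R⊆Ax P R ∘ ≋-tail Req ∘ ≋⇒⊆ R'eq))
    (axioms (P⊆Ax P' R' ∘ ≋-tail P'eq))
    (entails-≋∷ Req (≈⇒↔* (E⊆Ax P' R') s≈t ◅◅ t→d' ◅◅ ↔*-sym c≈d) (R⊆Ax P' R' ∘ ≋⇒⊇ R'eq))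
    where
    s→c : s ↔*[ Ax P R ] c
    s→c = axiom (R⊆Ax P R (≋-head Req))
    t→d : t ↔*[ Ax P R ] d
    t→d = axiom (R⊆Ax P R (≋-tail Req (here refl)))
    t→d' : t ↔*[ Ax P' R' ] d
    t→d' = axiom (R⊆Ax P' R' (≋-head R'eq))
    c≈d : c ↔*[ Ax P' R' ] d
    c≈d = axiom (P⊆Ax P' R' (≋-head P'eq))

  DELETE-interderivable : ∀ P R {P₀ s t} →
    P ≋ ((s , t) ∷ P₀) → s ≈[ E ] t → Interderivable (Ax P R) (Ax P₀ R)
  DELETE-interderivable P R {P₀} Peq s≈t = interderivable P R P₀ R
    (axioms (P⊆Ax P R ∘ ≋-tail Peq)) (axioms (R⊆Ax P R))
    (entails-≋∷ Peq (≈⇒↔* (E⊆Ax P₀ R) s≈t) (P⊆Ax P₀ R)) (axioms (R⊆Ax P₀ R))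

  replace-rule-interderivable : ∀ P R {R' R₀ a b e e'} → Repl a b e e' →
    R ≋ (e ∷ (a , b) ∷ R₀) → R' ≋ (e' ∷ (a , b) ∷ R₀) → Interderivable (Ax P R) (Ax P R')
  replace-rule-interderivable P R {R'} rp Req R'eq = interderivable P R P R'
    (axioms (P⊆Ax P R))
    (replace-entails rp (axiom (R⊆Ax P R (≋-tail Req (here refl)))) Req R'eq (R⊆Ax P R))
    (axioms (P⊆Ax P R'))
    (replace-entails (Repl-sym rp) (↔*-sym (axiom (R⊆Ax P R' (≋-tail R'eq (here refl)))))
                     R'eq Req (R⊆Ax P R'))

  EXTEND-sound : ∀ {K P R P' R' P₀ e e' t c u v} → IsState ⟨ K , P , R ⟩ →
    P ≋ (e ∷ P₀) → Repl t (con c) e e' → P' ≋ (e' ∷ P₀) → c ∉ K → R' ≋ ((t , con c) ∷ R) →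
    GroundOver K u → GroundOver K v → (u ↔*[ Ax P' R' ] v) ⇔ (u ↔*[ Ax P R ] v)
  EXTEND-sound {K} {P} {R} {P'} {R'} {e = e} {e'} {t} {c} {u} {v}
               (P-ground∈ , R-rules) Peq rp P'eq c∉K R'eq u-ground v-ground =
    mk⇔ forward (↔*-mono backward)
    where
    P-ground : All (GroundEqn K) P
    P-ground = All.tabulate (λ m → P-ground∈ m)

    R-ground : All (GroundEqn K) R
    R-ground = All.tabulate (λ m → rule-ground (R-rules m))

    e-ground : GroundEqn K e
    e-ground = All.lookup P-ground (≋-head Peq)

    t-ground : GroundOver K t
    t-ground = Repl-ground rp e-ground

    θ : ℕ → Term
    θ = c ↦ t

    θ-fixes : Fixes K θ
    θ-fixes = ↦-fixes t c∉K

    t≡c-image : t ⟦ θ ⟧ ≡ con c ⟦ θ ⟧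
    t≡c-image = trans (⟦⟧-ground θ-fixes t t-ground) (sym (↦-same c t))

    e'-image : e' ⟦ θ ⟧ₑ ≡ e
    e'-image = trans (sym (Repl-⟦⟧ t≡c-image rp)) (⟦⟧ₑ-ground θ-fixes e-ground)

    images : EntailsUnder θ (Ax P R) (Ax P' R')
    images = Ax-entailsUnder P R
      (anti-mono (≋⇒⊆ P'eq)
        (subst (Ax P R ⊨_) (sym e'-image) (axiom (P⊆Ax P R (≋-head Peq))) ∷
         fixed-axioms (P⊆Ax P R ∘ ≋-tail Peq)
                      (All.map (⟦⟧ₑ-ground θ-fixes) (anti-mono (≋-tail Peq) P-ground))))
      (anti-mono (≋⇒⊆ R'eq)
        (≡⇒↔* t≡c-image ∷ fixed-axioms (R⊆Ax P R) (All.map (⟦⟧ₑ-ground θ-fixes) R-ground)))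

    forward : u ↔*[ Ax P' R' ] v → u ↔*[ Ax P R ] v
    forward u↔v = subst₂ (λ a b → a ↔*[ Ax P R ] b)
      (⟦⟧-ground θ-fixes u u-ground) (⟦⟧-ground θ-fixes v v-ground)
      (↔*-⟦⟧ (↦-closed c t-ground) images u↔v)

    backward : Entails (Ax P' R') (Ax P R)
    backward = Ax-entails P' R'
      (replace-entails (Repl-sym rp) (↔*-sym (axiom (R⊆Ax P' R' (≋-head R'eq))))
                       P'eq Peq (P⊆Ax P' R'))
      (axioms (R⊆Ax P' R' ∘ ≋-tail R'eq))

  step-sound : ∀ {st st' u v} → IsState st → st ⊢[ E , B ] st' →
    GroundOver (State.K st) u → GroundOver (State.K st) v →
    (u ↔*[ Axioms E B st' ] v) ⇔ (u ↔*[ Axioms E B st ] v)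
  step-sound ok (EXTEND t c Peq rp P'eq _ c∉K R'eq) u-ground v-ground =
    EXTEND-sound ok Peq rp P'eq c∉K R'eq u-ground v-ground
  step-sound {⟨ _ , P , R ⟩} _ (SIMPLIFY t c Peq rp P'eq tc∈R) _ _ =
    interderivable⇒⇔ (SIMPLIFY-interderivable P R Peq rp P'eq tc∈R)
  step-sound {⟨ _ , P , R ⟩} _ (REWRITE l r σ _ _ Req lr∈B refl P'eq) _ _ =
    interderivable⇒⇔ (REWRITE-interderivable P R σ Req lr∈B P'eq)
  step-sound {⟨ _ , P , R ⟩} _ (ORIENT s t Peq _ _ R'eq) _ _ =
    interderivable⇒⇔ (ORIENT-interderivable P R Peq R'eq)
  step-sound {⟨ _ , P , R ⟩} _ (DEDUCE s c t d Req s≈t P'eq R'eq) _ _ =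
    interderivable⇒⇔ (DEDUCE-interderivable P R Req s≈t P'eq R'eq)
  step-sound {⟨ _ , P , R ⟩} _ (DELETE s t Peq s≈t) _ _ =
    interderivable⇒⇔ (DELETE-interderivable P R Peq s≈t)
  step-sound {⟨ _ , P , R ⟩} _ (COMPOSE t c d Req R'eq) _ _ =
    interderivable⇒⇔ (replace-rule-interderivable P R (right hole t) Req R'eq)
  step-sound {⟨ _ , P , R ⟩} _ (COLLAPSE C c c' d _ Req _ R'eq) _ _ =
    interderivable⇒⇔ (replace-rule-interderivable P R (left C c') Req R'eq)

-- Soundness of a single step does not need the commutativity assumption on g.
lemma1 : (S : Sig) → let open Over S in
    (E : List PermEq) (B : BSpec) → CommAssumption E B →
    (st st' : State) → IsState st → st ⊢[ E , B ] st' →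
    (u v : Term) → GroundOver (State.K st) u → GroundOver (State.K st) v →
    (u ↔*[ Axioms E B st' ] v) ⇔ (u ↔*[ Axioms E B st ] v)
lemma1 S E B _ _ _ st-ok step _ _ = Inference.step-sound S E B st-ok step
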